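{- Let $n\ge3$ be an odd integer. If the cycle $C_n$ admits an optimal extended irregular dominating set, then the cycle $C_{2n}$ admits an optimal extended irregular dominating set.
   Context: $C_m$ is the cycle of length $m$. For a graph $\Gamma=(V,E)$ with distance $d$: a vertex $v$ carrying a positive integer label $\ell$ dominates exactly the vertices $u$ with $d(u,v)=\ell$; a vertex carrying label $0$ dominates only itself. A $k$-extended irregular dominating set is a set $S\subseteq V$ of $k$ vertices with an injective labeling $\lambda:S\to\{0,1,2,\dots\}$ such that every vertex of $V$ is dominated by some vertex of $S$, where some vertex of $S$ has label $0$; $\gamma_e(\Gamma)$ is the minimum such $k$, and the set is optimal if $k=\gamma_e(\Gamma)$. -}

module Defs where

open import Data.Nat using (ℕ; zero; suc; _+_; _*_; _∸_; _⊓_; ∣_-_∣; _≤_)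
open import Data.Fin using (Fin; toℕ)
open import Data.Product using (Σ; ∃; _×_; _,_)
open import Relation.Binary.PropositionalEquality using (_≡_)
open import Function.Definitions using (Injective)

-- Graph distance in the cycle C_m on vertex set Fin m (vertices 0..m-1,
-- i adjacent to i±1 mod m):  d(i,j) = min(|i-j|, m-|i-j|).
cycleDist : (m : ℕ) → Fin m → Fin m → ℕ
cycleDist m i j = ∣ toℕ i - toℕ j ∣ ⊓ (m ∸ ∣ toℕ i - toℕ j ∣)

Dominates : (m : ℕ) → Fin m → ℕ → Fin m → Set
Dominates m v zero    u = u ≡ v
Dominates m v (suc ℓ) u = cycleDist m u v ≡ suc ℓ

record ExtIrrDomSet (m k : ℕ) : Set where
  field
    vertex    : Fin k → Fin m
    vertex-inj : Injective _≡_ _≡_ vertex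
    label     : Fin k → ℕ
    label-inj : Injective _≡_ _≡_ label
    hasZero   : ∃ λ i → label i ≡ 0
    dominating : (u : Fin m) → ∃ λ i → Dominates m (vertex i) (label i) u

OptimalExtIrrDomSet : (m k : ℕ) → Set
OptimalExtIrrDomSet m k = ExtIrrDomSet m k × ((k' : ℕ) → ExtIrrDomSet m k' → k ≤ k')

AdmitsOptimal : ℕ → Set
AdmitsOptimal m = ∃ λ k → OptimalExtIrrDomSet m k

-- An optimal set S of C_n misses some vertex: otherwise k ≥ n, while the labels of vertices that dominate
-- anything are at most n/2, so some vertex dominates nothing and could be dropped. Rotate C_n so that the
-- missed vertex is n - 1, and map C_n twice into C_2n by lift s a = 2a + s n (s = 0, 1). Inside one copy
-- distances double; the two copies are antipodal, so between them distance ℓ becomes n - 2ℓ. A vertex of S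
-- at position c with label ℓ yields lift s c and lift s (c + 1) with s = c mod 2, labelled 2ℓ or n - 2ℓ
-- according to whether they serve their own copy. As n is odd, parity keeps the 2k new vertices and labels
-- distinct. Finally a dominating set of C_2n of some size gives an optimal one, since after discarding
-- useless vertices the labels are bounded and the existence of a set of given size becomes decidable.
module Submission where

open import Data.Empty using (⊥-elim)
open import Data.Fin as Fin using (Fin; toℕ; fromℕ<; punchIn; punchOut; remQuot; combine)
open import Data.Fin.Properties
  using ( toℕ<n; toℕ-fromℕ<; toℕ-injective; any?; all?; ¬∀⟶∃¬; injective⇒≤
        ; punchIn-injective; punchIn-punchOut; remQuot-combine; combine-remQuot )
open import Data.Nat
open import Data.Nat.DivMod
open import Data.Nat.Divisibility using (_∣_; divides; m%n≡0⇒n∣m; quotient; m∣n⇒n≡quotient*m)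
open import Data.Nat.Induction using (<-rec)
open import Data.Nat.Properties
open import Data.Nat.Tactic.RingSolver using (solve-∀)
open import Data.Product
open import Data.Sum using (_⊎_; inj₁; inj₂; [_,_]′) renaming (swap to ⊎-swap)
open import Data.Vec using (Vec; []; _∷_; lookup; tabulate)
open import Data.Vec.Properties using (lookup∘tabulate)
open import Function using (_∘_; _⇔_; mk⇔; Equivalence)
open import Function.Definitions using (Injective)
open import Level using (0ℓ)
open import Relation.Binary.Bundles using (Setoid)
open import Relation.Binary.Definitions using (DecidableEquality)
open import Relation.Binary.PropositionalEquality
open import Relation.Nullary
open import Relation.Nullary.Decidable using (map′; _×-dec_; _→-dec_)
open import Relation.Unary using (Decidable)

open import Defs

-- A record rather than a synonym for x % d ≡ y % d, so that Agda can infer d, x and y from the type.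
record _≡_[mod_] (x y d : ℕ) .{{_ : NonZero d}} : Set where
  constructor mk≡[mod]
  field %≡% : x % d ≡ y % d

infix 4 _≡_[mod_]

module _ {d : ℕ} .{{_ : NonZero d}} where

  ≡⇒≡[mod] : ∀ {x y} → x ≡ y → x ≡ y [mod d ]
  ≡⇒≡[mod] refl = mk≡[mod] refl

  ≡[mod]-sym : ∀ {x y} → x ≡ y [mod d ] → y ≡ x [mod d ]
  ≡[mod]-sym (mk≡[mod] eq) = mk≡[mod] (sym eq)

  ≡[mod]-trans : ∀ {x y z} → x ≡ y [mod d ] → y ≡ z [mod d ] → x ≡ z [mod d ]
  ≡[mod]-trans (mk≡[mod] eq) (mk≡[mod] eq′) = mk≡[mod] (trans eq eq′)

modSetoid : (d : ℕ) .{{_ : NonZero d}} → Setoid 0ℓ 0ℓ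
modSetoid d = record
  { Carrier       = ℕ
  ; _≈_           = _≡_[mod d ]
  ; isEquivalence = record { refl = ≡⇒≡[mod] refl ; sym = ≡[mod]-sym ; trans = ≡[mod]-trans } }

module mod-Reasoning (d : ℕ) .{{_ : NonZero d}} where
  open import Relation.Binary.Reasoning.Setoid (modSetoid d) public

module _ {d : ℕ} .{{_ : NonZero d}} where

  %-≡[mod] : ∀ x → x % d ≡ x [mod d ]
  %-≡[mod] x = mk≡[mod] (m%n%n≡m%n x d)

  +-cong-[mod] : ∀ {x y u v} → x ≡ y [mod d ] → u ≡ v [mod d ] → x + u ≡ y + v [mod d ]
  +-cong-[mod] {x} {y} {u} {v} (mk≡[mod] x≡y) (mk≡[mod] u≡v) = mk≡[mod] (begin
    (x + u) % d             ≡⟨ %-distribˡ-+ x u d ⟩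
    (x % d + u % d) % d     ≡⟨ cong₂ (λ a b → (a + b) % d) x≡y u≡v ⟩
    (y % d + v % d) % d     ≡⟨ %-distribˡ-+ y v d ⟨
    (y + v) % d             ∎)
    where open ≡-Reasoning

  +-congˡ-[mod] : ∀ x {u v} → u ≡ v [mod d ] → x + u ≡ x + v [mod d ]
  +-congˡ-[mod] x = +-cong-[mod] (≡⇒≡[mod] refl)

  +-congʳ-[mod] : ∀ {x y} u → x ≡ y [mod d ] → x + u ≡ y + u [mod d ]
  +-congʳ-[mod] u x≡y = +-cong-[mod] x≡y (≡⇒≡[mod] refl)

  +-multiple-[mod] : ∀ x k → x + k * d ≡ x [mod d ]
  +-multiple-[mod] x k = mk≡[mod] ([m+kn]%n≡m%n x k d)

  ≡[mod]⇒≡ : ∀ {x y} → x < d → y < d → x ≡ y [mod d ] → x ≡ y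
  ≡[mod]⇒≡ x<d y<d (mk≡[mod] eq) = trans (sym (m<n⇒m%n≡m x<d)) (trans eq (m<n⇒m%n≡m y<d))

  +-inverse-[mod] : ∀ x → x + (d ∸ x % d) ≡ 0 [mod d ]
  +-inverse-[mod] x = begin
    x + (d ∸ x % d)      ≈⟨ +-congʳ-[mod] (d ∸ x % d) (%-≡[mod] x) ⟨
    x % d + (d ∸ x % d)  ≡⟨ m+[n∸m]≡n (m%n≤n x d) ⟩
    d                    ≡⟨ *-identityˡ d ⟨
    0 + 1 * d            ≈⟨ +-multiple-[mod] 0 1 ⟩
    0                    ∎
    where open mod-Reasoning d

  +-cancelʳ-[mod] : ∀ {x y} z → x + z ≡ y + z [mod d ] → x ≡ y [mod d ]
  +-cancelʳ-[mod] {x} {y} z eq = begin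
    x                        ≡⟨ +-identityʳ x ⟨
    x + 0                    ≈⟨ +-congˡ-[mod] x (+-inverse-[mod] z) ⟨
    x + (z + (d ∸ z % d))    ≡⟨ +-assoc x z _ ⟨
    x + z + (d ∸ z % d)      ≈⟨ +-congʳ-[mod] (d ∸ z % d) eq ⟩
    y + z + (d ∸ z % d)      ≡⟨ +-assoc y z _ ⟩
    y + (z + (d ∸ z % d))    ≈⟨ +-congˡ-[mod] y (+-inverse-[mod] z) ⟩
    y + 0                    ≡⟨ +-identityʳ y ⟩
    y                        ∎
    where open mod-Reasoning d

  toℕ-mod : ∀ x → toℕ (x mod d) ≡ x % d
  toℕ-mod x = toℕ-fromℕ< (m%n<n x d)

  toℕ-mod-≡[mod] : ∀ x → toℕ (x mod d) ≡ x [mod d ]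
  toℕ-mod-≡[mod] x = ≡[mod]-trans (≡⇒≡[mod] (toℕ-mod x)) (%-≡[mod] x)

-- Distance ℓ in C_M, read modulo M: one position is ℓ steps after the other (Dominates⇔Apart).
Apart : (M : ℕ) .{{_ : NonZero M}} → ℕ → ℕ → ℕ → Set
Apart M ℓ a b = ℓ + ℓ ≤ M × (ℓ + a ≡ b [mod M ] ⊎ ℓ + b ≡ a [mod M ])

module _ {M : ℕ} .{{_ : NonZero M}} where

  Apart-sym : ∀ {ℓ a b} → Apart M ℓ a b → Apart M ℓ b a
  Apart-sym = map₂ ⊎-swap

  Apart-resp-≡[mod] : ∀ {ℓ a a′ b b′} → a ≡ a′ [mod M ] → b ≡ b′ [mod M ] →
                      Apart M ℓ a b → Apart M ℓ a′ b′
  Apart-resp-≡[mod] {ℓ} a≡a′ b≡b′ (ℓℓ≤M , inj₁ e) =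
    ℓℓ≤M , inj₁ (≡[mod]-trans (≡[mod]-sym (+-congˡ-[mod] ℓ a≡a′)) (≡[mod]-trans e b≡b′))
  Apart-resp-≡[mod] {ℓ} a≡a′ b≡b′ (ℓℓ≤M , inj₂ e) =
    ℓℓ≤M , inj₂ (≡[mod]-trans (≡[mod]-sym (+-congˡ-[mod] ℓ b≡b′)) (≡[mod]-trans e a≡a′))

  Apart-+ : ∀ {ℓ a b} r → Apart M ℓ a b → Apart M ℓ (a + r) (b + r)
  Apart-+ {ℓ} {a} {b} r (ℓℓ≤M , off) = ℓℓ≤M , [ inj₁ ∘ shift a , inj₂ ∘ shift b ]′ off
    where
    shift : ∀ x {y} → ℓ + x ≡ y [mod M ] → ℓ + (x + r) ≡ y + r [mod M ]
    shift x e = ≡[mod]-trans (≡⇒≡[mod] (sym (+-assoc ℓ x r))) (+-congʳ-[mod] r e)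

  half<M : ∀ {ℓ} → ℓ + ℓ ≤ M → ℓ < M
  half<M {zero}  _     = >-nonZero⁻¹ M
  half<M {suc ℓ} ℓℓ≤M = <-≤-trans (m<m+n (suc ℓ) z<s) ℓℓ≤M

  0%M≡0 : 0 % M ≡ 0
  0%M≡0 = m<n⇒m%n≡m (>-nonZero⁻¹ M)

  ≡0[mod]⇒ : ∀ {x} → x < M + M → x ≡ 0 [mod M ] → x ≡ 0 ⊎ x ≡ M
  ≡0[mod]⇒ {x} x<2M (mk≡[mod] x≡0) with x <? M
  ... | yes x<M = inj₁ (trans (sym (m<n⇒m%n≡m x<M)) (trans x≡0 0%M≡0))
  ... | no  x≮M = inj₂ (≤-antisym (m∸n≡0⇒m≤n x∸M≡0) M≤x)
    where
    M≤x : M ≤ x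
    M≤x = ≮⇒≥ x≮M
    x∸M≡0 : x ∸ M ≡ 0
    x∸M≡0 = begin
      x ∸ M          ≡⟨ m<n⇒m%n≡m (+-cancelʳ-< M (x ∸ M) M (subst (_< M + M) (sym (m∸n+n≡m M≤x)) x<2M)) ⟨
      (x ∸ M) % M    ≡⟨ m≤n⇒[n∸m]%m≡n%m M≤x ⟩
      x % M          ≡⟨ x≡0 ⟩
      0 % M          ≡⟨ 0%M≡0 ⟩
      0              ∎
      where open ≡-Reasoning

  ⊓-complement⇒ : ∀ {D ℓ} → D ≤ M → D ⊓ (M ∸ D) ≡ ℓ → ℓ + ℓ ≤ M × (D ≡ ℓ ⊎ D + ℓ ≡ M)
  ⊓-complement⇒ {D} D≤M refl with ≤-total D (M ∸ D)
  ... | inj₁ D≤M∸D rewrite m≤n⇒m⊓n≡m D≤M∸D =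
    ≤-trans (+-monoʳ-≤ D D≤M∸D) (≤-reflexive (m+[n∸m]≡n D≤M)) , inj₁ refl
  ... | inj₂ M∸D≤D rewrite m≥n⇒m⊓n≡n M∸D≤D =
    ≤-trans (+-monoʳ-≤ (M ∸ D) M∸D≤D) (≤-reflexive (m∸n+n≡m D≤M)) , inj₂ (m+[n∸m]≡n D≤M)

  ⊓-complement⇐ : ∀ {D ℓ} → ℓ + ℓ ≤ M → D ≡ ℓ ⊎ D + ℓ ≡ M → D ⊓ (M ∸ D) ≡ ℓ
  ⊓-complement⇐ {ℓ = ℓ} ℓℓ≤M (inj₁ refl) = m≤n⇒m⊓n≡m (m+n≤o⇒m≤o∸n ℓ ℓℓ≤M)
  ⊓-complement⇐ {D} {ℓ} ℓℓ≤M (inj₂ refl) =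
    trans (cong (D ⊓_) (m+n∸m≡n D ℓ)) (m≥n⇒m⊓n≡n (+-cancelʳ-≤ ℓ ℓ D ℓℓ≤M))

  offset⇒≡[mod] : ∀ {b D ℓ} → D ≡ ℓ ⊎ D + ℓ ≡ M →
                  ℓ + b ≡ b + D [mod M ] ⊎ ℓ + (b + D) ≡ b [mod M ]
  offset⇒≡[mod] {b} {D} (inj₁ refl) = inj₁ (≡⇒≡[mod] (+-comm D b))
  offset⇒≡[mod] {b} {D} {ℓ} (inj₂ D+ℓ≡M) = inj₂ (begin
    ℓ + (b + D)    ≡⟨ trans (+-comm ℓ (b + D)) (+-assoc b D ℓ) ⟩
    b + (D + ℓ)    ≡⟨ cong (b +_) (trans D+ℓ≡M (sym (*-identityˡ M))) ⟩
    b + 1 * M      ≈⟨ +-multiple-[mod] b 1 ⟩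
    b              ∎)
    where open mod-Reasoning M

  ≡[mod]⇒offset : ∀ {b D ℓ} → b + D < M → ℓ < M →
                  ℓ + b ≡ b + D [mod M ] ⊎ ℓ + (b + D) ≡ b [mod M ] → D ≡ ℓ ⊎ D + ℓ ≡ M
  ≡[mod]⇒offset {b} {D} {ℓ} b+D<M ℓ<M (inj₁ e) =
    inj₁ (sym (≡[mod]⇒≡ ℓ<M D<M (+-cancelʳ-[mod] b (≡[mod]-trans e (≡⇒≡[mod] (+-comm b D))))))
    where
    D<M : D < M
    D<M = ≤-<-trans (m≤n+m D b) b+D<M
  ≡[mod]⇒offset {b} {D} {ℓ} b+D<M ℓ<M (inj₂ e) =
    [ (λ D+ℓ≡0 → inj₁ (trans (m+n≡0⇒m≡0 D D+ℓ≡0) (sym (m+n≡0⇒n≡0 D D+ℓ≡0)))) , inj₂ ]′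
      (≡0[mod]⇒ (+-mono-< (≤-<-trans (m≤n+m D b) b+D<M) ℓ<M) D+ℓ≡0)
    where
    D+ℓ≡0 : D + ℓ ≡ 0 [mod M ]
    D+ℓ≡0 = +-cancelʳ-[mod] b (≡[mod]-trans (≡⇒≡[mod] rearrange) e)
      where
      rearrange : D + ℓ + b ≡ ℓ + (b + D)
      rearrange = trans (+-comm (D + ℓ) b) (trans (sym (+-assoc b D ℓ)) (+-comm (b + D) ℓ))

  private
    ordered⇒Apart : ∀ {a b ℓ} → b ≤ a → a < M → ∣ b - a ∣ ⊓ (M ∸ ∣ b - a ∣) ≡ ℓ → Apart M ℓ b a
    ordered⇒Apart {b = b} b≤a a<M eq with m≤n⇒∃[o]m+o≡n b≤a
    ... | D , refl = map₂ offset⇒≡[mod]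
      (⊓-complement⇒ (≤-trans (m≤n+m D b) (<⇒≤ a<M)) (trans (cong (λ x → x ⊓ (M ∸ x)) (sym (∣m-m+n∣≡n b D))) eq))

    Apart⇒ordered : ∀ {a b ℓ} → b ≤ a → a < M → Apart M ℓ b a → ∣ b - a ∣ ⊓ (M ∸ ∣ b - a ∣) ≡ ℓ
    Apart⇒ordered {b = b} b≤a a<M (ℓℓ≤M , off) with m≤n⇒∃[o]m+o≡n b≤a
    ... | D , refl = trans (cong (λ x → x ⊓ (M ∸ x)) (∣m-m+n∣≡n b D))
      (⊓-complement⇐ ℓℓ≤M (≡[mod]⇒offset a<M (half<M ℓℓ≤M) off))

  cycleDist-sym : ∀ (u v : Fin M) → cycleDist M u v ≡ cycleDist M v u
  cycleDist-sym u v = cong (λ D → D ⊓ (M ∸ D)) (∣-∣-comm (toℕ u) (toℕ v))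

  cycleDist≡⇒Apart : ∀ {u v : Fin M} {ℓ} → cycleDist M u v ≡ ℓ → Apart M ℓ (toℕ v) (toℕ u)
  cycleDist≡⇒Apart {u} {v} eq with ≤-total (toℕ v) (toℕ u)
  ... | inj₁ v≤u = ordered⇒Apart v≤u (toℕ<n u) (trans (cycleDist-sym v u) eq)
  ... | inj₂ u≤v = Apart-sym (ordered⇒Apart u≤v (toℕ<n v) eq)

  Apart⇒cycleDist≡ : ∀ {u v : Fin M} {ℓ} → Apart M ℓ (toℕ v) (toℕ u) → cycleDist M u v ≡ ℓ
  Apart⇒cycleDist≡ {u} {v} apart with ≤-total (toℕ v) (toℕ u)
  ... | inj₁ v≤u = trans (cycleDist-sym u v) (Apart⇒ordered v≤u (toℕ<n u) apart)
  ... | inj₂ u≤v = Apart⇒ordered u≤v (toℕ<n v) (Apart-sym apart)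

  -- Label 0 fits the same pattern: Apart M 0 a b says exactly a ≡ b [mod M].
  Dominates⇔Apart : ∀ {v u : Fin M} {ℓ} → Dominates M v ℓ u ⇔ Apart M ℓ (toℕ v) (toℕ u)
  Dominates⇔Apart {v} {u} {ℓ} = mk⇔ to from
    where
    to : ∀ {ℓ} → Dominates M v ℓ u → Apart M ℓ (toℕ v) (toℕ u)
    to {zero}  refl = z≤n , inj₁ (≡⇒≡[mod] refl)
    to {suc ℓ} d    = cycleDist≡⇒Apart d
    from : ∀ {ℓ} → Apart M ℓ (toℕ v) (toℕ u) → Dominates M v ℓ u
    from {zero}  (_ , inj₁ e) = sym (toℕ-injective (≡[mod]⇒≡ (toℕ<n v) (toℕ<n u) e))
    from {zero}  (_ , inj₂ e) = toℕ-injective (≡[mod]⇒≡ (toℕ<n u) (toℕ<n v) e)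
    from {suc ℓ} apart        = Apart⇒cycleDist≡ apart

Useful : ∀ {M k} → ExtIrrDomSet M k → Set
Useful {M} E = ∀ i → label i + label i ≤ M
  where open ExtIrrDomSet E

removeVertex : ∀ {M k} (E : ExtIrrDomSet M (suc k)) (i : Fin (suc k)) →
               (∀ u → ¬ Dominates M (ExtIrrDomSet.vertex E i) (ExtIrrDomSet.label E i) u) →
               ExtIrrDomSet M k
removeVertex {M} E i idle = record
  { vertex     = vertex ∘ punchIn i
  ; vertex-inj = punchIn-injective i _ _ ∘ vertex-inj
  ; label      = label ∘ punchIn i
  ; label-inj  = punchIn-injective i _ _ ∘ label-inj
  ; hasZero    = let j , ℓⱼ≡0 = hasZero in
                 punchOut (i≢zero j ℓⱼ≡0) , trans (cong label (punchIn-punchOut (i≢zero j ℓⱼ≡0))) ℓⱼ≡0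
  ; dominating = λ u → let j , d = dominating u in
                 punchOut (i≢dominator u j d) ,
                 subst (λ z → Dominates M (vertex z) (label z) u) (sym (punchIn-punchOut (i≢dominator u j d))) d
  }
  where
  open ExtIrrDomSet E
  i≢dominator : ∀ u j → Dominates M (vertex j) (label j) u → i ≢ j
  i≢dominator u j d refl = idle u d
  -- a vertex labelled 0 dominates itself
  i≢zero : ∀ j → label j ≡ 0 → i ≢ j
  i≢zero j ℓⱼ≡0 = i≢dominator (vertex j) j (subst (λ ℓ → Dominates M (vertex j) ℓ (vertex j)) (sym ℓⱼ≡0) refl)

module _ {M : ℕ} .{{_ : NonZero M}} where

  removeUseless : ∀ {k} (E : ExtIrrDomSet M (suc k)) (i : Fin (suc k)) →
                  ¬ (ExtIrrDomSet.label E i + ExtIrrDomSet.label E i ≤ M) → ExtIrrDomSet M k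
  removeUseless E i useless = removeVertex E i λ u d →
    useless (proj₁ (Equivalence.to Dominates⇔Apart d))

  optimal⇒useful : ∀ {k} → ((E , _) : OptimalExtIrrDomSet M k) → Useful E
  optimal⇒useful {suc k} (E , optimal) i with label i + label i ≤? M
    where open ExtIrrDomSet E
  ... | yes useful = useful
  ... | no  useless = contradiction (optimal k (removeUseless E i useless)) (n≮n k)

  prune : ∀ {k} → ExtIrrDomSet M k → ∃₂ λ k′ (E′ : ExtIrrDomSet M k′) → k′ ≤ k × Useful E′
  prune {zero}  E = zero , E , ≤-refl , λ ()
  prune {suc k} E with all? (λ i → label i + label i ≤? M)
    where open ExtIrrDomSet E
  ... | yes useful = suc k , E , ≤-refl , useful
  ... | no ¬useful =
    let i , useless = ¬∀⟶∃¬ _ _ (λ i → label i + label i ≤? M) ¬useful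
        k′ , E′ , k′≤k , useful′ = prune (removeUseless E i useless)
    in k′ , E′ , m≤n⇒m≤1+n k′≤k , useful′
    where open ExtIrrDomSet E

  useful-label<M∸1 : ∀ {ℓ} → 3 ≤ M → ℓ + ℓ ≤ M → ℓ < M ∸ 1
  useful-label<M∸1 {ℓ} 3≤M ℓℓ≤M = m+n≤o⇒m≤o∸n (suc ℓ) {1} (subst (_≤ M) (cong suc (+-comm 1 ℓ)) (2+ℓ≤M ℓℓ≤M))
    where
    2+ℓ≤M : ∀ {ℓ} → ℓ + ℓ ≤ M → 2 + ℓ ≤ M
    2+ℓ≤M {0}           _    = ≤-trans (s≤s (s≤s z≤n)) 3≤M
    2+ℓ≤M {1}           _    = 3≤M
    2+ℓ≤M {suc (suc m)} ℓℓ≤M = ≤-trans (s≤s (s≤s (m≤n+m (suc (suc m)) m))) ℓℓ≤M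

  -- Pigeonhole twice: covering every vertex needs k ≥ M, but useful labels take fewer than M - 1 values.
  useful⇒missesVertex : ∀ {k} → 3 ≤ M → (E : ExtIrrDomSet M k) → Useful E →
                        ∃ λ x → ∀ i → ExtIrrDomSet.vertex E i ≢ x
  useful⇒missesVertex {k} 3≤M E useful with any? (λ x → all? (λ i → ¬? (vertex i Fin.≟ x)))
    where open ExtIrrDomSet E
  ... | yes missed = missed
  ... | no ¬missed = ⊥-elim (n≮n (M ∸ 1) (subst (_≤ M ∸ 1) (sym (suc-pred M)) (≤-trans M≤k k≤M∸1)))
    where
    open ExtIrrDomSet E
    hit : ∀ x → ∃ λ i → vertex i ≡ x
    hit x with any? (λ i → vertex i Fin.≟ x)
    ... | yes h = h
    ... | no ¬h = contradiction (x , λ i eq → ¬h (i , eq)) ¬missed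
    M≤k : M ≤ k
    M≤k = injective⇒≤ {f = proj₁ ∘ hit} λ {x} {y} eq →
      trans (sym (proj₂ (hit x))) (trans (cong vertex eq) (proj₂ (hit y)))
    k≤M∸1 : k ≤ M ∸ 1
    k≤M∸1 = injective⇒≤ {f = λ i → fromℕ< (useful-label<M∸1 3≤M (useful i))} λ {i} {j} eq →
      label-inj (trans (sym (toℕ-fromℕ< _)) (trans (cong toℕ eq) (toℕ-fromℕ< _)))

  rotate : ℕ → Fin M → Fin M
  rotate r u = (toℕ u + r) mod M

  toℕ-rotate : ∀ r u → toℕ (rotate r u) ≡ toℕ u + r [mod M ]
  toℕ-rotate r u = toℕ-mod-≡[mod] (toℕ u + r)

  rotate-injective : ∀ r → Injective _≡_ _≡_ (rotate r)
  rotate-injective r {u} {v} eq = toℕ-injective (≡[mod]⇒≡ (toℕ<n u) (toℕ<n v) (+-cancelʳ-[mod] r (begin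
    toℕ u + r          ≈⟨ toℕ-rotate r u ⟨
    toℕ (rotate r u)   ≡⟨ cong toℕ eq ⟩
    toℕ (rotate r v)   ≈⟨ toℕ-rotate r v ⟩
    toℕ v + r          ∎)))
    where open mod-Reasoning M

  rotate-inverse : ∀ r y → rotate r (rotate (M ∸ r % M) y) ≡ y
  rotate-inverse r y = toℕ-injective (≡[mod]⇒≡ (toℕ<n _) (toℕ<n y) (begin
    toℕ (rotate r (rotate s y))   ≈⟨ toℕ-rotate r _ ⟩
    toℕ (rotate s y) + r          ≈⟨ +-congʳ-[mod] r (toℕ-rotate s y) ⟩
    toℕ y + s + r                 ≡⟨ trans (+-assoc (toℕ y) s r) (cong (toℕ y +_) (+-comm s r)) ⟩
    toℕ y + (r + s)               ≈⟨ +-congˡ-[mod] (toℕ y) (+-inverse-[mod] r) ⟩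
    toℕ y + 0                     ≡⟨ +-identityʳ (toℕ y) ⟩
    toℕ y                         ∎))
    where
    open mod-Reasoning M
    s : ℕ
    s = M ∸ r % M

  rotate-Dominates : ∀ r {v ℓ u} → Dominates M v ℓ u → Dominates M (rotate r v) ℓ (rotate r u)
  rotate-Dominates r {v} {ℓ} {u} d = Equivalence.from Dominates⇔Apart
    (Apart-resp-≡[mod] (≡[mod]-sym (toℕ-rotate r v)) (≡[mod]-sym (toℕ-rotate r u)) (Apart-+ r (Equivalence.to Dominates⇔Apart d)))

  rotateEIDS : ∀ {k} → ℕ → ExtIrrDomSet M k → ExtIrrDomSet M k
  rotateEIDS r E = record
    { vertex     = rotate r ∘ vertex
    ; vertex-inj = vertex-inj ∘ rotate-injective r
    ; label      = label
    ; label-inj  = label-inj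
    ; hasZero    = hasZero
    ; dominating = λ w → let i , d = dominating (rotate (M ∸ r % M) w) in
                   i , subst (Dominates M _ (label i)) (rotate-inverse r w) (rotate-Dominates r d)
    }
    where open ExtIrrDomSet E

  toLast : Fin M → ℕ
  toLast x = M ∸ suc (toℕ x)

  rotate-toLast : ∀ x → toℕ (rotate (toLast x) x) ≡ M ∸ 1
  rotate-toLast x = begin
    toℕ (rotate (toLast x) x)   ≡⟨ toℕ-mod (toℕ x + toLast x) ⟩
    (toℕ x + toLast x) % M      ≡⟨ cong (λ y → pred y % M) (m+[n∸m]≡n (toℕ<n x)) ⟩
    (M ∸ 1) % M                 ≡⟨ m<n⇒m%n≡m (≤-reflexive (suc-pred M)) ⟩
    M ∸ 1                       ∎
    where open ≡-Reasoning

  rotateEIDS-avoidsLast : ∀ {k} (E : ExtIrrDomSet M k) x → (∀ i → ExtIrrDomSet.vertex E i ≢ x) →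
                          ∀ i → suc (toℕ (ExtIrrDomSet.vertex (rotateEIDS (toLast x) E) i)) < M
  rotateEIDS-avoidsLast E x missed i =
    subst (suc (suc (toℕ v)) ≤_) (suc-pred M) (s≤s (≤∧≢⇒< (<⇒≤pred (toℕ<n v)) v≢last))
    where
    v : Fin M
    v = rotate (toLast x) (ExtIrrDomSet.vertex E i)
    v≢last : toℕ v ≢ M ∸ 1
    v≢last eq = missed i (rotate-injective (toLast x) (toℕ-injective (trans eq (sym (rotate-toLast x)))))

IsLeast : (ℕ → Set) → ℕ → Set
IsLeast P k = P k × (∀ {k′} → P k′ → k ≤ k′)

minimal : ∀ {P : ℕ → Set} → Decidable P → ∀ {K} → P K → ∃ (IsLeast P)
minimal {P} P? {K} = <-rec (λ K → P K → ∃ (IsLeast P)) step K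
  where
  step : ∀ K → (∀ {K′} → K′ < K → P K′ → ∃ (IsLeast P)) → P K → ∃ (IsLeast P)
  step K rec pK with anyUpTo? P? K
  ... | yes (K′ , K′<K , pK′) = rec K′<K pK′
  ... | no  none              = K , pK , λ {k′} pk′ → ≮⇒≥ λ k′<K → none (k′ , k′<K , pk′)

∃-Vec? : ∀ {m} k {P : Vec (Fin m) k → Set} → Decidable P → Dec (∃ P)
∃-Vec? zero    P? = map′ ([] ,_) (λ { ([] , p) → p }) (P? [])
∃-Vec? (suc k) P? = map′ (λ (a , v , p) → a ∷ v , p) (λ { (a ∷ v , p) → a , v , p })
                         (any? λ a → ∃-Vec? k (P? ∘ (a ∷_)))

injective? : ∀ {k} {A : Set} → DecidableEquality A → (f : Fin k → A) → Dec (Injective _≡_ _≡_ f)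
injective? _≟_ f = map′ (λ inj {i} {j} → inj i j) (λ inj i j → inj {i} {j})
                        (all? λ i → all? λ j → (f i ≟ f j) →-dec (i Fin.≟ j))

Dominates? : ∀ M (v : Fin M) ℓ u → Dec (Dominates M v ℓ u)
Dominates? M v zero    u = u Fin.≟ v
Dominates? M v (suc ℓ) u = cycleDist M u v ≟ suc ℓ

IsUsefulEIDS : ∀ M {k} → (Fin k → Fin M) → (Fin k → ℕ) → Set
IsUsefulEIDS M vertex label =
  Injective _≡_ _≡_ vertex × Injective _≡_ _≡_ label × (∃ λ i → label i ≡ 0) ×
  (∀ u → ∃ λ i → Dominates M (vertex i) (label i) u) × (∀ i → label i + label i ≤ M)

isUsefulEIDS? : ∀ M {k} (vertex : Fin k → Fin M) label → Dec (IsUsefulEIDS M vertex label)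
isUsefulEIDS? M vertex label =
  injective? Fin._≟_ vertex ×-dec injective? _≟_ label ×-dec any? (λ i → label i ≟ 0) ×-dec
  all? (λ u → any? λ i → Dominates? M (vertex i) (label i) u) ×-dec all? (λ i → label i + label i ≤? M)

IsUsefulEIDS-resp-≗ : ∀ {M k} {f f′ : Fin k → Fin M} {g g′ : Fin k → ℕ} → f ≗ f′ → g ≗ g′ →
                      IsUsefulEIDS M f g → IsUsefulEIDS M f′ g′
IsUsefulEIDS-resp-≗ {M} f≗f′ g≗g′ (f-inj , g-inj , (i₀ , gi₀≡0) , dom , useful) =
  (λ {i} {j} eq → f-inj (trans (f≗f′ i) (trans eq (sym (f≗f′ j))))) ,
  (λ {i} {j} eq → g-inj (trans (g≗g′ i) (trans eq (sym (g≗g′ j))))) ,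
  (i₀ , trans (sym (g≗g′ i₀)) gi₀≡0) ,
  (λ u → let i , d = dom u in i , subst₂ (λ v ℓ → Dominates M v ℓ u) (f≗f′ i) (g≗g′ i) d) ,
  (λ i → subst (λ ℓ → ℓ + ℓ ≤ M) (g≗g′ i) (useful i))

UsefulEIDS : ℕ → ℕ → Set
UsefulEIDS M k = Σ (ExtIrrDomSet M k) Useful

-- Useful labels are at most M, so a useful set is a finite object that can be searched for.
usefulEIDS? : ∀ M k → Dec (UsefulEIDS M k)
usefulEIDS? M k = map′ decode encode
  (∃-Vec? k λ vs → ∃-Vec? k λ ls → isUsefulEIDS? M (lookup vs) (toℕ ∘ lookup {A = Fin (suc M)} ls))
  where
  decode : (∃ λ vs → ∃ λ ls → IsUsefulEIDS M (lookup vs) (toℕ ∘ lookup ls)) → UsefulEIDS M k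
  decode (vs , ls , v-inj , ℓ-inj , has0 , dom , useful) = record
    { vertex = lookup vs ; vertex-inj = v-inj ; label = toℕ ∘ lookup ls ; label-inj = ℓ-inj
    ; hasZero = has0 ; dominating = dom } , useful
  encode : UsefulEIDS M k → ∃ λ vs → ∃ λ ls → IsUsefulEIDS M (lookup vs) (toℕ ∘ lookup ls)
  encode (E , useful) = tabulate vertex , tabulate label′ ,
    IsUsefulEIDS-resp-≗ (sym ∘ lookup∘tabulate vertex)
                        (λ i → sym (trans (cong toℕ (lookup∘tabulate label′ i)) (toℕ-fromℕ< _)))
                        (vertex-inj , label-inj , hasZero , dominating , useful)
    where
    open ExtIrrDomSet E
    label′ : Fin k → Fin (suc M)
    label′ i = fromℕ< (s≤s (m+n≤o⇒m≤o (label i) (useful i)))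

admitsOptimal : ∀ {M k} .{{_ : NonZero M}} → ExtIrrDomSet M k → AdmitsOptimal M
admitsOptimal {M} E =
  let k′ , E′ , _ , useful′ = prune E
      k₀ , (E₀ , _) , least = minimal (usefulEIDS? M) (E′ , useful′)
  in k₀ , E₀ , λ k″ E″ → let k‴ , E‴ , k‴≤k″ , useful‴ = prune E″ in ≤-trans (least (E‴ , useful‴)) k‴≤k″

m+m≤n⇒2*m≤n : ∀ {m n} → m + m ≤ n → 2 * m ≤ n
m+m≤n⇒2*m≤n {m} {n} = subst (_≤ n) (cong (m +_) (sym (+-identityʳ m)))

2*m%2≡0 : ∀ m → (2 * m) % 2 ≡ 0
2*m%2≡0 m = trans (cong (_% 2) (*-comm 2 m)) (m*n%n≡0 m 2)

module _ {n : ℕ} .{{_ : NonZero n}} where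

  private instance
    2n≢0 : NonZero (2 * n)
    2n≢0 = m*n≢0 2 n

  double-% : ∀ x → (2 * x) % (2 * n) ≡ 2 * (x % n)
  double-% x = begin
    (2 * x) % (2 * n)    ≡⟨ cong (_% (2 * n)) (*-comm 2 x) ⟩
    (x * 2) % (2 * n)    ≡⟨ %-congʳ {o = x * 2} (*-comm 2 n) ⟩
    (x * 2) % (n * 2)    ≡⟨ m%n*o≡m*o%[n*o] x n 2 ⟨
    (x % n) * 2          ≡⟨ *-comm (x % n) 2 ⟩
    2 * (x % n)          ∎
    where
    open ≡-Reasoning
    instance
      n2≢0 : NonZero (n * 2)
      n2≢0 = m*n≢0 n 2

  *2-≡[mod] : ∀ {x y} → x ≡ y [mod n ] → 2 * x ≡ 2 * y [mod 2 * n ]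
  *2-≡[mod] {x} {y} (mk≡[mod] eq) = mk≡[mod] (trans (double-% x) (trans (cong (2 *_) eq) (sym (double-% y))))

  lift : Fin 2 → ℕ → ℕ
  lift s a = 2 * a + toℕ s * n

  lift-injective : ∀ {s a b} → a < n → b < n → lift s a ≡ lift s b [mod 2 * n ] → a ≡ b
  lift-injective {s} a<n b<n eq =
    *-cancelˡ-≡ _ _ 2 (≡[mod]⇒≡ (*-monoʳ-< 2 a<n) (*-monoʳ-< 2 b<n) (+-cancelʳ-[mod] (toℕ s * n) eq))

  lift-same : ∀ {ℓ a b} s → ℓ + a ≡ b [mod n ] → 2 * ℓ + lift s a ≡ lift s b [mod 2 * n ]
  lift-same {ℓ} {a} {b} s eq = begin
    2 * ℓ + (2 * a + toℕ s * n)   ≡⟨ trans (sym (+-assoc (2 * ℓ) _ _)) (cong (_+ toℕ s * n) (sym (*-distribˡ-+ 2 ℓ a))) ⟩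
    2 * (ℓ + a) + toℕ s * n       ≈⟨ +-congʳ-[mod] (toℕ s * n) (*2-≡[mod] eq) ⟩
    2 * b + toℕ s * n             ∎
    where open mod-Reasoning (2 * n)

  sheet-swap : ∀ {s s′ : Fin 2} → s ≢ s′ → n + toℕ s′ * n ≡ toℕ s * n [mod 2 * n ]
  sheet-swap {Fin.zero}           {Fin.zero}           s≢s′ = contradiction refl s≢s′
  sheet-swap {Fin.zero}           {Fin.suc Fin.zero}   _    =
    ≡[mod]-trans (≡⇒≡[mod] (sym (+-identityʳ (2 * n)))) (+-multiple-[mod] 0 1)
  sheet-swap {Fin.suc Fin.zero}   {Fin.zero}           _    = ≡⇒≡[mod] refl
  sheet-swap {Fin.suc Fin.zero}   {Fin.suc Fin.zero}   s≢s′ = contradiction refl s≢s′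

  lift-cross : ∀ {ℓ a b} {s s′ : Fin 2} → s ≢ s′ → 2 * ℓ ≤ n → ℓ + a ≡ b [mod n ] →
               (n ∸ 2 * ℓ) + lift s′ b ≡ lift s a [mod 2 * n ]
  lift-cross {ℓ} {a} {b} {s} {s′} s≢s′ 2ℓ≤n eq = begin
    (n ∸ 2 * ℓ) + (2 * b + toℕ s′ * n)          ≈⟨ +-congˡ-[mod] (n ∸ 2 * ℓ) (+-congʳ-[mod] (toℕ s′ * n) (*2-≡[mod] eq)) ⟨
    (n ∸ 2 * ℓ) + (2 * (ℓ + a) + toℕ s′ * n)    ≡⟨ rearrange (n ∸ 2 * ℓ) ℓ a (toℕ s′ * n) ⟩
    2 * a + ((n ∸ 2 * ℓ) + 2 * ℓ + toℕ s′ * n)  ≡⟨ cong (λ m → 2 * a + (m + toℕ s′ * n)) (m∸n+n≡m 2ℓ≤n) ⟩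
    2 * a + (n + toℕ s′ * n)                    ≈⟨ +-congˡ-[mod] (2 * a) (sheet-swap s≢s′) ⟩
    2 * a + toℕ s * n                           ∎
    where
    open mod-Reasoning (2 * n)
    rearrange : ∀ m ℓ a t → m + (2 * (ℓ + a) + t) ≡ 2 * a + (m + 2 * ℓ + t)
    rearrange = solve-∀

  Apart-lift-same : ∀ {ℓ a b} s → Apart n ℓ a b → Apart (2 * n) (2 * ℓ) (lift s a) (lift s b)
  Apart-lift-same {ℓ} {a} {b} s (ℓℓ≤n , off) =
    subst (_≤ 2 * n) (*-distribˡ-+ 2 ℓ ℓ) (*-monoʳ-≤ 2 ℓℓ≤n) ,
    [ inj₁ ∘ lift-same {ℓ} {a} {b} s , inj₂ ∘ lift-same {ℓ} {b} {a} s ]′ off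

  Apart-lift-cross : ∀ {ℓ a b} {s s′ : Fin 2} → s ≢ s′ →
                     Apart n ℓ a b → Apart (2 * n) (n ∸ 2 * ℓ) (lift s a) (lift s′ b)
  Apart-lift-cross {ℓ} {a} {b} s≢s′ (ℓℓ≤n , off) =
    ≤-trans (+-mono-≤ (m∸n≤m n (2 * ℓ)) (m∸n≤m n (2 * ℓ))) (≤-reflexive (cong (n +_) (sym (+-identityʳ n)))) ,
    [ inj₂ ∘ lift-cross {ℓ} {a} {b} s≢s′ 2ℓ≤n , inj₁ ∘ lift-cross {ℓ} {b} {a} (s≢s′ ∘ sym) 2ℓ≤n ]′ off
    where
    2ℓ≤n : 2 * ℓ ≤ n
    2ℓ≤n = m+m≤n⇒2*m≤n {ℓ} ℓℓ≤n

  ≡[mod2n]⇒%2≡ : ∀ {x y} → x ≡ y [mod 2 * n ] → x % 2 ≡ y % 2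
  ≡[mod2n]⇒%2≡ {x} {y} (mk≡[mod] eq) = begin
    x % 2              ≡⟨ m∣n⇒o%n%m≡o%m 2 (2 * n) x 2∣2n ⟨
    x % (2 * n) % 2    ≡⟨ cong (_% 2) eq ⟩
    y % (2 * n) % 2    ≡⟨ m∣n⇒o%n%m≡o%m 2 (2 * n) y 2∣2n ⟩
    y % 2              ∎
    where
    open ≡-Reasoning
    2∣2n : 2 ∣ 2 * n
    2∣2n = divides n (*-comm 2 n)

  module _ (odd : n % 2 ≡ 1) where

    sheet-%2 : ∀ (s : Fin 2) → (toℕ s * n) % 2 ≡ toℕ s
    sheet-%2 Fin.zero           = refl
    sheet-%2 (Fin.suc Fin.zero) = trans (cong (_% 2) (+-identityʳ n)) odd

    lift-%2 : ∀ s a → lift s a % 2 ≡ toℕ s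
    lift-%2 s a = trans (%-remove-+ˡ (toℕ s * n) (divides a (*-comm 2 a))) (sheet-%2 s)

    +sheet-even : ∀ w → (w + toℕ (w mod 2) * n) % 2 ≡ 0
    +sheet-even w = begin
      (w + toℕ s * n) % 2              ≡⟨ %-distribˡ-+ w (toℕ s * n) 2 ⟩
      (w % 2 + (toℕ s * n) % 2) % 2    ≡⟨ cong₂ (λ x y → (x + y) % 2) (sym (toℕ-mod {d = 2} w)) (sheet-%2 s) ⟩
      (toℕ s + toℕ s) % 2              ≡⟨ cong (λ x → (toℕ s + x) % 2) (sym (+-identityʳ (toℕ s))) ⟩
      (2 * toℕ s) % 2                  ≡⟨ 2*m%2≡0 (toℕ s) ⟩
      0                                ∎
      where
      open ≡-Reasoning
      s : Fin 2
      s = w mod 2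

    lift-surjective : ∀ w → ∃₂ λ s a → lift s a ≡ w [mod 2 * n ]
    lift-surjective w = s , q , (begin
      2 * q + toℕ s * n               ≡⟨ cong (_+ toℕ s * n) (trans (*-comm 2 q) (sym Z≡q*2)) ⟩
      Z + toℕ s * n                   ≈⟨ +-congʳ-[mod] (toℕ s * n) (%-≡[mod] (w + toℕ s * n)) ⟩
      w + toℕ s * n + toℕ s * n       ≡⟨ double-sheet w (toℕ s) n ⟩
      w + toℕ s * (2 * n)             ≈⟨ +-multiple-[mod] w (toℕ s) ⟩
      w                               ∎)
      where
      open mod-Reasoning (2 * n)
      s : Fin 2
      s = w mod 2
      Z : ℕ
      Z = (w + toℕ s * n) % (2 * n)
      Z%2≡0 : Z % 2 ≡ 0
      Z%2≡0 = trans (≡[mod2n]⇒%2≡ (%-≡[mod] (w + toℕ s * n))) (+sheet-even w)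
      q : ℕ
      q = quotient (m%n≡0⇒n∣m Z 2 Z%2≡0)
      Z≡q*2 : Z ≡ q * 2
      Z≡q*2 = m∣n⇒n≡quotient*m (m%n≡0⇒n∣m Z 2 Z%2≡0)
      double-sheet : ∀ w t n → w + t * n + t * n ≡ w + t * (2 * n)
      double-sheet = solve-∀

m+0≡n+1⇒1+n≡m : ∀ {m n} → m + 0 ≡ n + 1 → suc n ≡ m
m+0≡n+1⇒1+n≡m {m} {n} eq = trans (+-comm 1 n) (sym (trans (sym (+-identityʳ m)) eq))

suc-%2≢ : ∀ m → suc m % 2 ≢ m % 2
suc-%2≢ zero          ()
suc-%2≢ (suc zero)    ()
suc-%2≢ (suc (suc m)) = suc-%2≢ m

≢-unique-Fin2 : ∀ {s t t′ : Fin 2} → s ≢ t → s ≢ t′ → t ≡ t′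
≢-unique-Fin2 {Fin.zero}         {Fin.zero}         s≢t _    = contradiction refl s≢t
≢-unique-Fin2 {Fin.suc Fin.zero} {Fin.suc Fin.zero} s≢t _    = contradiction refl s≢t
≢-unique-Fin2 {Fin.zero}         {_} {Fin.zero}         _ s≢t′ = contradiction refl s≢t′
≢-unique-Fin2 {Fin.suc Fin.zero} {_} {Fin.suc Fin.zero} _ s≢t′ = contradiction refl s≢t′
≢-unique-Fin2 {Fin.zero}         {Fin.suc Fin.zero} {Fin.suc Fin.zero} _ _ = refl
≢-unique-Fin2 {Fin.suc Fin.zero} {Fin.zero}         {Fin.zero}         _ _ = refl

-- The copy newVertex t i of vertex i serves the targets on sheet t.
module Doubling {n k : ℕ} .{{_ : NonZero n}} (odd : n % 2 ≡ 1)
                (E : ExtIrrDomSet n k) (useful : Useful E)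
                (avoidsLast : ∀ i → suc (toℕ (ExtIrrDomSet.vertex E i)) < n) where

  open ExtIrrDomSet E

  private instance
    2n≢0 : NonZero (2 * n)
    2n≢0 = m*n≢0 2 n

  pos : Fin k → ℕ
  pos i = toℕ (vertex i)

  sheet : Fin k → Fin 2
  sheet i = pos i mod 2

  newVertex : Fin 2 → Fin k → Fin (2 * n)
  newVertex t i = lift (sheet i) (pos i + toℕ t) mod (2 * n)

  newLabel : Fin 2 → Fin k → ℕ
  newLabel t i with sheet i Fin.≟ t
  ... | yes _ = 2 * label i
  ... | no  _ = n ∸ 2 * label i

  2ℓ≤n : ∀ i → 2 * label i ≤ n
  2ℓ≤n i = m+m≤n⇒2*m≤n {label i} (useful i)

  pos+t<n : ∀ (t : Fin 2) i → pos i + toℕ t < n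
  pos+t<n Fin.zero           i = subst (_< n) (sym (+-identityʳ (pos i))) (<-trans (n<1+n (pos i)) (avoidsLast i))
  pos+t<n (Fin.suc Fin.zero) i = subst (_< n) (+-comm 1 (pos i)) (avoidsLast i)

  newVertex-%2 : ∀ t i → toℕ (newVertex t i) % 2 ≡ toℕ (sheet i)
  newVertex-%2 t i = trans (≡[mod2n]⇒%2≡ {n = n} (toℕ-mod-≡[mod] (lift (sheet i) (pos i + toℕ t))))
                           (lift-%2 odd (sheet i) (pos i + toℕ t))

  newVertex-injective : ∀ {t i t′ i′} → newVertex t i ≡ newVertex t′ i′ → t ≡ t′ × i ≡ i′
  newVertex-injective {t} {i} {t′} {i′} eq = resolve t t′ shifted-positions-≡
    where
    sheets-≡ : sheet i ≡ sheet i′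
    sheets-≡ = toℕ-injective (trans (sym (newVertex-%2 t i)) (trans (cong (λ v → toℕ v % 2) eq) (newVertex-%2 t′ i′)))
    parities-≡ : pos i % 2 ≡ pos i′ % 2
    parities-≡ = trans (sym (toℕ-mod (pos i))) (trans (cong toℕ sheets-≡) (toℕ-mod (pos i′)))
    shifted-positions-≡ : pos i + toℕ t ≡ pos i′ + toℕ t′
    shifted-positions-≡ = lift-injective {s = sheet i′} (pos+t<n t i) (pos+t<n t′ i′) (begin
      lift (sheet i′) (pos i + toℕ t)     ≡⟨ cong (λ s → lift s (pos i + toℕ t)) sheets-≡ ⟨
      lift (sheet i) (pos i + toℕ t)      ≈⟨ toℕ-mod-≡[mod] _ ⟨
      toℕ (newVertex t i)                 ≡⟨ cong toℕ eq ⟩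
      toℕ (newVertex t′ i′)               ≈⟨ toℕ-mod-≡[mod] _ ⟩
      lift (sheet i′) (pos i′ + toℕ t′)   ∎)
      where open mod-Reasoning (2 * n)
    -- the two copies of one vertex sit on the same sheet at consecutive positions, which have different parities
    resolve : ∀ t t′ → pos i + toℕ t ≡ pos i′ + toℕ t′ → t ≡ t′ × i ≡ i′
    resolve Fin.zero           Fin.zero           p = refl , vertex-inj (toℕ-injective (+-cancelʳ-≡ 0 _ _ p))
    resolve (Fin.suc Fin.zero) (Fin.suc Fin.zero) p = refl , vertex-inj (toℕ-injective (+-cancelʳ-≡ 1 _ _ p))
    resolve Fin.zero           (Fin.suc Fin.zero) p =
      contradiction (trans (cong (_% 2) (m+0≡n+1⇒1+n≡m p)) parities-≡) (suc-%2≢ (pos i′))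
    resolve (Fin.suc Fin.zero) Fin.zero           p =
      contradiction (trans (cong (_% 2) (m+0≡n+1⇒1+n≡m (sym p))) (sym parities-≡)) (suc-%2≢ (pos i))

  newLabel-same : ∀ {t i} → sheet i ≡ t → newLabel t i ≡ 2 * label i
  newLabel-same {t} {i} s≡t with sheet i Fin.≟ t
  ... | yes _   = refl
  ... | no  s≢t = contradiction s≡t s≢t

  n∸2ℓ%2≡1 : ∀ i → (n ∸ 2 * label i) % 2 ≡ 1
  n∸2ℓ%2≡1 i = begin
    (n ∸ 2 * label i) % 2                  ≡⟨ %-remove-+ˡ (n ∸ 2 * label i) (divides (label i) (*-comm 2 (label i))) ⟨
    (2 * label i + (n ∸ 2 * label i)) % 2  ≡⟨ cong (_% 2) (m+[n∸m]≡n (2ℓ≤n i)) ⟩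
    n % 2                                  ≡⟨ odd ⟩
    1                                      ∎
    where open ≡-Reasoning

  -- same-sheet labels 2ℓ are even and cross-sheet labels n - 2ℓ are odd
  newLabel-injective : ∀ {t i t′ i′} → newLabel t i ≡ newLabel t′ i′ → t ≡ t′ × i ≡ i′
  newLabel-injective {t} {i} {t′} {i′} eq with sheet i Fin.≟ t | sheet i′ Fin.≟ t′
  ... | yes refl | yes refl = cong sheet i≡i′ , i≡i′
    where
    i≡i′ : i ≡ i′
    i≡i′ = label-inj (*-cancelˡ-≡ _ _ 2 eq)
  ... | no s≢t   | no s′≢t′ = ≢-unique-Fin2 s≢t (subst (λ j → sheet j ≢ t′) (sym i≡i′) s′≢t′) , i≡i′
    where
    i≡i′ : i ≡ i′
    i≡i′ = label-inj (*-cancelˡ-≡ _ _ 2 (∸-cancelˡ-≡ (2ℓ≤n i) (2ℓ≤n i′) eq))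
  ... | yes _    | no _     = contradiction (trans (sym (2*m%2≡0 (label i))) (trans (cong (_% 2) eq) (n∸2ℓ%2≡1 i′))) 0≢1+n
  ... | no _     | yes _    = contradiction (trans (sym (2*m%2≡0 (label i′))) (trans (cong (_% 2) (sym eq)) (n∸2ℓ%2≡1 i))) 0≢1+n

  newVertex-Apart : ∀ t j {b} → Apart n (label j) (pos j + toℕ t) b →
                    Apart (2 * n) (newLabel t j) (toℕ (newVertex t j)) (lift t b)
  newVertex-Apart t j {b} apart with sheet j Fin.≟ t
  ... | yes refl = Apart-resp-≡[mod] (≡[mod]-sym (toℕ-mod-≡[mod] _)) (≡⇒≡[mod] refl)
                                     (Apart-lift-same {a = pos j + toℕ t} {b} (sheet j) apart)
  ... | no  s≢t  = Apart-resp-≡[mod] (≡[mod]-sym (toℕ-mod-≡[mod] _)) (≡⇒≡[mod] refl)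
                                     (Apart-lift-cross {a = pos j + toℕ t} {b} s≢t apart)

  unshift : ∀ (s : Fin 2) y → toℕ ((y + (n ∸ toℕ s)) mod n) + toℕ s ≡ y [mod n ]
  unshift s y = begin
    toℕ ((y + (n ∸ toℕ s)) mod n) + toℕ s   ≈⟨ +-congʳ-[mod] (toℕ s) (toℕ-mod-≡[mod] (y + (n ∸ toℕ s))) ⟩
    y + (n ∸ toℕ s) + toℕ s                 ≡⟨ +-assoc y _ _ ⟩
    y + (n ∸ toℕ s + toℕ s)                 ≡⟨ cong (y +_) (trans (m∸n+n≡m s≤n) (sym (*-identityˡ n))) ⟩
    y + 1 * n                               ≈⟨ +-multiple-[mod] y 1 ⟩
    y                                       ∎
    where
    open mod-Reasoning n
    s≤n : toℕ s ≤ n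
    s≤n = ≤-trans (≤-pred (toℕ<n s)) (>-nonZero⁻¹ n)

  newDominating : ∀ w → ∃₂ λ t j → Dominates (2 * n) (newVertex t j) (newLabel t j) w
  newDominating w with lift-surjective odd (toℕ w)
  ... | s , y , lift≡w with dominating ((y + (n ∸ toℕ s)) mod n)
  ...   | j , d = s , j , Equivalence.from Dominates⇔Apart
                              (Apart-resp-≡[mod] (≡⇒≡[mod] refl) lift≡w (newVertex-Apart s j apart))
    where
    apart : Apart n (label j) (pos j + toℕ s) y
    apart = Apart-resp-≡[mod] (≡⇒≡[mod] refl) (unshift s y) (Apart-+ (toℕ s) (Equivalence.to Dominates⇔Apart d))

  remQuot-injective : ∀ {j j′ : Fin (2 * k)} → remQuot {2} k j ≡ remQuot {2} k j′ → j ≡ j′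
  remQuot-injective {j} {j′} eq =
    trans (sym (combine-remQuot {2} k j)) (trans (cong (uncurry combine) eq) (combine-remQuot {2} k j′))

  doubled : ExtIrrDomSet (2 * n) (2 * k)
  doubled = record
    { vertex     = uncurry newVertex ∘ remQuot {2} k
    ; vertex-inj = remQuot-injective ∘ uncurry (cong₂ _,_) ∘ newVertex-injective
    ; label      = uncurry newLabel ∘ remQuot {2} k
    ; label-inj  = remQuot-injective ∘ uncurry (cong₂ _,_) ∘ newLabel-injective
    ; hasZero    = let i , ℓ≡0 = hasZero in
                   combine (sheet i) i ,
                   trans (cong (uncurry newLabel) (remQuot-combine (sheet i) i)) (trans (newLabel-same refl) (cong (2 *_) ℓ≡0))
    ; dominating = λ w → let t , j , d = newDominating w in
                   combine t j ,
                   subst (λ p → Dominates (2 * n) (uncurry newVertex p) (uncurry newLabel p) w) (sym (remQuot-combine t j)) d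
    }

proposition4p8 : (n : ℕ) → 3 ≤ n → n % 2 ≡ 1 → AdmitsOptimal n → AdmitsOptimal (2 * n)
proposition4p8 n 3≤n odd (k , optimal@(E , _)) = admitsOptimal (Doubling.doubled odd E′ useful avoidsLast)
  where
  instance
    n≢0 : NonZero n
    n≢0 = >-nonZero (≤-trans (s≤s z≤n) 3≤n)
    2n≢0 : NonZero (2 * n)
    2n≢0 = m*n≢0 2 n
  useful : Useful E
  useful = optimal⇒useful optimal
  missing : ∃ λ x → ∀ i → ExtIrrDomSet.vertex E i ≢ x
  missing = useful⇒missesVertex 3≤n E useful
  E′ : ExtIrrDomSet n k
  E′ = rotateEIDS (toLast (proj₁ missing)) E
  avoidsLast : ∀ i → suc (toℕ (ExtIrrDomSet.vertex E′ i)) < n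
  avoidsLast = rotateEIDS-avoidsLast E (proj₁ missing) (proj₂ missing)
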